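{- Let $m$ and $d$ be positive integers. Let $G$ be a graph with a vertex partition $(A,B)$ such that every connected component of $G[A]$ and every connected component of $G[B]$ has rank-depth at most $m$, and $\rho_G(A)\le d$. Then $G$ has rank-depth at most $m+d+1$.
   Context: Graphs are finite and simple. The cut-rank $\rho_G(S)$ of $S\subseteq V(G)$ is the $\mathrm{GF}(2)$-rank of the $S\times(V(G)\setminus S)$ submatrix of the adjacency matrix of $G$. A decomposition of $G$ is a pair $(T,\sigma)$ with $T$ a tree and $\sigma$ a bijection from $V(G)$ to the leaves of $T$. For a non-leaf node $v$, the components of $T-v$ give via $\sigma$ a partition $\mathcal P_v$ of $V(G)$, and the width of $v$ is $\max_{\mathcal P'\subseteq\mathcal P_v}\rho_G(\bigcup_{X\in\mathcal P'}X)$. The width of $(T,\sigma)$ is the maximum width of a non-leaf node, and its radius is the radius of $T$. The rank-depth of $G$ is the least $k$ such that $G$ has a decomposition of width at most $k$ and radius at most $k$; it is $0$ if $|V(G)|<2$. -}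

module Defs where

open import Data.Nat using (ℕ; zero; suc; _≤_)
open import Data.Fin using (Fin; zero; suc; fromℕ; inject₁)
open import Data.Bool using (Bool; true; false; _∧_; _xor_)
open import Data.Product using (Σ; Σ-syntax; _×_; ∃; ∃-syntax)
open import Data.Sum using (_⊎_)
open import Data.Unit using (⊤)
open import Relation.Nullary using (¬_)
open import Relation.Binary.PropositionalEquality using (_≡_)

-- A finite simple graph on vertex set Fin n (adjacency over Bool = GF(2)).
record Graph (n : ℕ) : Set where
  field
    adj   : Fin n → Fin n → Bool
    sym   : ∀ u v → adj u v ≡ adj v u
    irrefl : ∀ v → adj v v ≡ false
open Graph public

data Walk {n : ℕ} (G : Graph n) (X : Fin n → Set) : Fin n → Fin n → ℕ → Set where
  here : ∀ {u} → X u → Walk G X u u 0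
  step : ∀ {u v w l} → X u → adj G u v ≡ true → Walk G X v w l → Walk G X u w (suc l)

Reach : {n : ℕ} → Graph n → (Fin n → Set) → Fin n → Fin n → Set
Reach G X u w = ∃[ l ] Walk G X u w l

All : {n : ℕ} → Fin n → Set
All _ = ⊤

Connected : {n : ℕ} → Graph n → Set
Connected G = ∀ u w → Reach G All u w

Cycle : {n : ℕ} → Graph n → Set
Cycle {n} G =
  Σ[ k ∈ ℕ ] Σ[ c ∈ (Fin (suc (suc (suc k))) → Fin n) ]
    (∀ i j → c i ≡ c j → i ≡ j)
    × (∀ (i : Fin (suc (suc k))) → adj G (c (inject₁ i)) (c (suc i)) ≡ true)
    × (adj G (c (fromℕ (suc (suc k)))) (c zero) ≡ true)

IsTree : {n : ℕ} → Graph n → Set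
IsTree G = Connected G × ¬ Cycle G

IsLeaf : {t : ℕ} → Graph t → Fin t → Set
IsLeaf T x = ∀ u w → adj T x u ≡ true → adj T x w ≡ true → u ≡ w

RadiusAtMost : {t : ℕ} → Graph t → ℕ → Set
RadiusAtMost T k = Σ[ c ∈ _ ] ∀ x → Σ[ l ∈ ℕ ] (l ≤ k × Walk T All c x l)

⊕-sum : {k : ℕ} → (Fin k → Bool) → Bool
⊕-sum {zero}  f = false
⊕-sum {suc k} f = f zero xor ⊕-sum (λ i → f (suc i))

-- Cut-rank in the induced subgraph G[X]: ρ_{G[X]}(S ∩ X) ≤ k, i.e. the GF(2)
-- row space of the (X∩S) × (X∖S) submatrix of the adjacency matrix is
-- spanned by k vectors (its dimension, the rank, is at most k).
CutRankAtMost : {n : ℕ} → Graph n → (Fin n → Set) → (Fin n → Bool) → ℕ → Set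
CutRankAtMost {n} G X S k =
  Σ[ b ∈ (Fin k → Fin n → Bool) ]
    ∀ v → X v → S v ≡ true →
      Σ[ c ∈ (Fin k → Bool) ]
        ∀ w → X w → S w ≡ false → adj G v w ≡ ⊕-sum (λ i → c i ∧ b i w)

-- Width of node v of a decomposition (T, σ) of G[X] is at most k: every union
-- of parts of P_v (i.e. every S ⊆ X that is constant on each part, the parts
-- being the classes of vertices whose leaves are joined in T - v) has cut-rank ≤ k.
WidthAtMost : {n t : ℕ} → Graph n → (Fin n → Set) → Graph t → (Fin n → Fin t) →
              Fin t → ℕ → Set
WidthAtMost G X T σ v k =
  ∀ (S : Fin _ → Bool) →
    (∀ i j → X i → X j → Reach T (λ y → ¬ y ≡ v) (σ i) (σ j) → S i ≡ S j) →
    CutRankAtMost G X S k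

HasDecomposition : {n : ℕ} → Graph n → (Fin n → Set) → ℕ → Set
HasDecomposition {n} G X k =
  Σ[ t ∈ ℕ ] Σ[ T ∈ Graph t ] Σ[ σ ∈ (Fin n → Fin t) ]
    IsTree T
    × (∀ x → X x → IsLeaf T (σ x))
    × (∀ x y → X x → X y → σ x ≡ σ y → x ≡ y)
    × (∀ l → IsLeaf T l → Σ[ x ∈ Fin n ] (X x × σ x ≡ l))
    × (∀ v → ¬ IsLeaf T v → WidthAtMost G X T σ v k)
    × RadiusAtMost T k

-- rank-depth of G[X] is at most m (rank-depth is 0 when |X| < 2, otherwise the
-- least k admitting a decomposition of width ≤ k and radius ≤ k).
RankDepthAtMost : {n : ℕ} → Graph n → (Fin n → Set) → ℕ → Set
RankDepthAtMost G X m =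
  (∀ x y → X x → X y → x ≡ y) ⊎ Σ[ k ∈ ℕ ] (k ≤ m × HasDecomposition G X k)

Component : {n : ℕ} → Graph n → (Fin n → Bool) → Bool → Fin n → Fin n → Set
Component G A b a x = A x ≡ b × Reach G (λ y → A y ≡ b) a x

module Submission where

-- Take a decomposition of every component and re-root it so that a
-- new neighbour can be attached to its root without creating or destroying
-- leaves (`RootedDecomposition`; a two-vertex component is replaced by the
-- star with two leaves, which is where m ≥ 1 is used).  Glue these trees into
-- one (module `Glue`): two adjacent hubs, one per side, with the root of every
-- component of side s joined to the hub of s.  Every node is within distance
-- m + 2 ≤ m + d + 1 of a hub.  At a block node of component C, a union of
-- parts avoiding the other side lies in C, and its cut is the cut inside C
-- (rank ≤ m) plus edges to the other side (rank ≤ d); unions of parts that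
-- meet the other side are complements of these.  At a hub only edges between
-- the sides are cut (rank ≤ d).  If one side is empty, the component of one
-- vertex is split off instead, a cut of rank 0.  The file first develops walks,
-- cycles, components, GF(2) rank bounds, rooted decompositions and finite
-- disjoint unions, then the gluing, and derives the theorem at the end.

open import Defs
open import Data.Nat using (ℕ; _+_; _≤_)
open import Data.Fin using (Fin)
open import Data.Bool using (Bool; true; false)
open import Relation.Binary.PropositionalEquality using (_≡_)

open import Data.Nat using (zero; suc; _∸_; _<_; z≤n; s≤s)
import Data.Nat as ℕ
import Data.Nat.Properties as ℕP
open import Data.Fin using (zero; suc; toℕ; fromℕ; fromℕ<; inject₁; lower₁; _↑ˡ_; _↑ʳ_; splitAt)
import Data.Fin as F
import Data.Fin.Properties as FP
open import Data.Fin.Properties using (any?; all?; pigeonhole)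
open import Data.Bool using (not; _∧_; _xor_)
import Data.Bool as B
open import Data.Bool.Properties
  using (¬-not; not-¬; not-injective; not-involutive; ∧-conicalˡ; ∧-conicalʳ; ∧-zeroʳ; ∧-identityʳ; ∧-comm;
         xor-assoc; xor-comm; xor-identityʳ; xor-same; xor-inverseʳ)
open import Data.Maybe using (Maybe; just; nothing; fromMaybe)
open import Data.Maybe.Properties using (just-injective)
open import Data.Product using (Σ-syntax; _×_; _,_; proj₁; proj₂)
open import Data.Sum using (_⊎_; inj₁; inj₂; [_,_]′)
open import Data.Unit using (⊤; tt)
open import Data.Empty using (⊥; ⊥-elim)
open import Function using (_∘_)
open import Data.Vec.Functional using (_++_)
open import Data.Vec.Functional.Properties using (lookup-++ˡ; lookup-++ʳ)
open import Function.Bundles using (mk⇔)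
open import Relation.Nullary using (¬_; Dec; yes; no; does)
open import Relation.Nullary.Decidable using (dec-true; dec-false; does-⇔; _×-dec_; _→-dec_; ¬?; decidable-stable)
open import Axiom.UniquenessOfIdentityProofs using (module Decidable⇒UIP)
open import Relation.Binary.PropositionalEquality
  using (_≢_; refl; trans; cong; cong₂; subst; subst₂; module ≡-Reasoning) renaming (sym to ≡-sym)

true⇒holds : ∀ {P : Set} (p : Dec P) → does p ≡ true → P
true⇒holds (yes p) _ = p

two-of-three : ∀ (a b c : Bool) → a ≡ b ⊎ a ≡ c ⊎ b ≡ c
two-of-three true  true  _     = inj₁ refl
two-of-three false false _     = inj₁ refl
two-of-three true  false true  = inj₂ (inj₁ refl)
two-of-three true  false false = inj₂ (inj₂ refl)
two-of-three false true  true  = inj₂ (inj₂ refl)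
two-of-three false true  false = inj₂ (inj₁ refl)

module _ {n : ℕ} {G : Graph n} where

  walk-source : ∀ {X u w l} → Walk G X u w l → X u
  walk-source (here x)     = x
  walk-source (step x _ _) = x

  walk-++ : ∀ {X u v w l l'} → Walk G X u v l → Walk G X v w l' → Walk G X u w (l + l')
  walk-++ (here _)     W' = W'
  walk-++ (step x a W) W' = step x a (walk-++ W W')

  walk-snoc : ∀ {X u v w l} → Walk G X u v l → adj G v w ≡ true → X w → Walk G X u w (suc l)
  walk-snoc (here x)     a xw = step x a (here xw)
  walk-snoc (step x a W) a' xw = step x a (walk-snoc W a' xw)

  walk-reverse : ∀ {X u w l} → Walk G X u w l → Walk G X w u l
  walk-reverse (here x) = here x
  walk-reverse (step {u} {v} x a W) = walk-snoc (walk-reverse W) (trans (Graph.sym G v u) a) x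

  walk-weaken : ∀ {X Y : Fin n → Set} → (∀ y → X y → Y y) → ∀ {u w l} → Walk G X u w l → Walk G Y u w l
  walk-weaken f (here x)     = here (f _ x)
  walk-weaken f (step x a W) = step (f _ x) a (walk-weaken f W)

  reach-refl : ∀ {X u} → X u → Reach G X u u
  reach-refl x = 0 , here x

  reach-sym : ∀ {X u w} → Reach G X u w → Reach G X w u
  reach-sym (l , W) = l , walk-reverse W

  reach-trans : ∀ {X u v w} → Reach G X u v → Reach G X v w → Reach G X u w
  reach-trans (l , W) (l' , W') = l + l' , walk-++ W W'

  reach-weaken : ∀ {X Y : Fin n → Set} → (∀ y → X y → Y y) → ∀ {u w} → Reach G X u w → Reach G Y u w
  reach-weaken f (l , W) = l , walk-weaken f W

  walk-reachable : ∀ {X u w l} → Walk G X u w l → Walk G (λ y → X y × Reach G X u y) u w l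
  walk-reachable (here x) = here (x , reach-refl x)
  walk-reachable {X} {u} (step x a W) = step (x , reach-refl x) a (walk-weaken extend (walk-reachable W))
    where extend : ∀ y → X y × Reach G X _ y → X y × Reach G X u y
          extend y (xy , (l , V)) = xy , (suc l , step x a V)

  vertex-at : ∀ {X u w l} → Walk G X u w l → Fin (suc l) → Fin n
  vertex-at {u = u} W zero = u
  vertex-at (step _ _ W) (suc i) = vertex-at W i

  walk-from : ∀ {X u w l} (W : Walk G X u w l) (j : Fin (suc l)) → Walk G X (vertex-at W j) w (l ∸ toℕ j)
  walk-from W zero = W
  walk-from (step _ _ W) (suc j) = walk-from W j

  cut-repetition : ∀ {X u w l} (W : Walk G X u w l) (i j : Fin (suc l)) →
                   toℕ i < toℕ j → vertex-at W i ≡ vertex-at W j → Σ[ l' ∈ ℕ ] (l' < l × Walk G X u w l')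
  cut-repetition {X} {w = w} (step {l = l} _ _ W) zero (suc j) _ eq =
    l ∸ toℕ j , s≤s (ℕP.m∸n≤m l (toℕ j)) , subst (λ z → Walk G X z w (l ∸ toℕ j)) (≡-sym eq) (walk-from W j)
  cut-repetition (step x a W) (suc i) (suc j) (s≤s i<j) eq with cut-repetition W i j i<j eq
  ... | l' , l'<l , W' = suc l' , s≤s l'<l , step x a W'

  -- By the pigeonhole principle every reachable vertex is reachable by a walk
  -- of length < n; the fuel bounds the length of the current walk.
  shorten-walk : ∀ {X u w} fuel l → l ≤ fuel → Walk G X u w l → Σ[ l' ∈ ℕ ] (l' < n × Walk G X u w l')
  shorten-walk fuel l l≤fuel W with l ℕP.<? n
  ... | yes l<n = l , l<n , W
  shorten-walk {u = u} zero zero _ W | no l≮n = ⊥-elim (l≮n (ℕP.≤-trans (s≤s z≤n) (FP.toℕ<n u)))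
  shorten-walk (suc fuel) l l≤fuel W | no l≮n
    with pigeonhole (ℕP.≰⇒> l≮n) (vertex-at W)
  ... | i , j , i<j , eq with cut-repetition W i j i<j eq
  ... | l' , l'<l , W' = shorten-walk fuel l' (ℕP.≤-pred (ℕP.≤-trans l'<l l≤fuel)) W'

  module _ {X : Fin n → Set} (X? : ∀ y → Dec (X y)) where
    walk? : ∀ l u w → Dec (Walk G X u w l)
    walk? zero u w with X? u | u F.≟ w
    ... | yes x | yes refl = yes (here x)
    ... | no ¬x | _        = no λ W → ¬x (walk-source W)
    ... | yes _ | no u≢w   = no λ { (here _) → u≢w refl }
    walk? (suc l) u w with X? u | any? (λ v → (adj G u v B.≟ true) ×-dec walk? l v w)
    ... | no ¬x | _               = no λ W → ¬x (walk-source W)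
    ... | yes x | yes (v , a , W) = yes (step x a W)
    ... | yes _ | no ¬step        = no λ { (step _ a W) → ¬step (_ , a , W) }

    reach? : ∀ u w → Dec (Reach G X u w)
    reach? u w with any? (λ (l : Fin n) → walk? (toℕ l) u w)
    ... | yes (l , W) = yes (toℕ l , W)
    ... | no ¬short = no λ { (l , W) → let (l' , l'<n , W') = shorten-walk l l ℕP.≤-refl W in
            ¬short (fromℕ< l'<n , subst (Walk G X u w) (≡-sym (FP.toℕ-fromℕ< l'<n)) W') }

-- The cyclic successor on Fin (suc N), along which the cycles of `Cycle` are
-- traversed.

next : ∀ {N} → Fin (suc N) → Fin (suc N)
next {N} i with N ℕ.≟ toℕ i
... | yes _   = zero
... | no N≢i = suc (lower₁ i N≢i)

next-last : ∀ {N} (i : Fin (suc N)) → N ≡ toℕ i → next i ≡ zero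
next-last {N} i N≡i with N ℕ.≟ toℕ i
... | yes _   = refl
... | no N≢i = ⊥-elim (N≢i N≡i)

toℕ-next : ∀ {N} (i : Fin (suc N)) → N ≢ toℕ i → toℕ (next i) ≡ suc (toℕ i)
toℕ-next {N} i N≢i with N ℕ.≟ toℕ i
... | yes N≡i = ⊥-elim (N≢i N≡i)
... | no N≢i' = cong suc (FP.toℕ-lower₁ i N≢i')

next²-≢ : ∀ {N} → 2 ≤ N → (j : Fin (suc N)) → next (next j) ≢ j
next²-≢ {N} (s≤s (s≤s _)) j loop = cases (N ℕ.≟ toℕ j) (N ℕ.≟ toℕ (next j))
  where
    open ≡-Reasoning
    N≢1 : N ≢ 1
    N≢1 ()
    cases : Dec (N ≡ toℕ j) → Dec (N ≡ toℕ (next j)) → ⊥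
    cases (yes j-last) _ = N≢1 (begin
      N                    ≡⟨ j-last ⟩
      toℕ j                ≡⟨ cong toℕ loop ⟨
      toℕ (next (next j))  ≡⟨ cong (toℕ ∘ next) (next-last j j-last) ⟩
      toℕ (next {N} zero)  ≡⟨ toℕ-next {N} zero (λ ()) ⟩
      1                    ∎)
    cases (no _) (yes nj-last) = N≢1 (begin
      N                    ≡⟨ nj-last ⟩
      toℕ (next j)         ≡⟨ cong (toℕ ∘ next) j≡0 ⟩
      toℕ (next {N} zero)  ≡⟨ toℕ-next {N} zero (λ ()) ⟩
      1                    ∎)
      where j≡0 : j ≡ zero
            j≡0 = trans (≡-sym loop) (next-last (next j) nj-last)
    cases (no j≢last) (no nj≢last) = ℕP.m≢1+n+m (toℕ j) {1} (begin
      toℕ j                   ≡⟨ cong toℕ loop ⟨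
      toℕ (next (next j))     ≡⟨ toℕ-next (next j) nj≢last ⟩
      suc (toℕ (next j))      ≡⟨ cong suc (toℕ-next j j≢last) ⟩
      suc (suc (toℕ j))       ∎)

module _ {N : ℕ} {P : Fin (suc N) → Set} (closed : ∀ i → P i → P (next i)) where
  climb : ∀ d i j → toℕ j ≡ toℕ i + d → P i → P j
  climb zero i j j≡i Pi = subst P (FP.toℕ-injective (trans (≡-sym (ℕP.+-identityʳ _)) (≡-sym j≡i))) Pi
  climb (suc d) i j j≡i+d Pi = climb d (next i) j j≡next+d (closed i Pi)
    where
      i≢last : N ≢ toℕ i
      i≢last N≡i = ℕP.<⇒≱ (FP.toℕ<n j)
        (subst (suc N ℕ.≤_) (≡-sym (trans j≡i+d (cong (_+ suc d) (≡-sym N≡i))))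
               (subst (suc N ℕ.≤_) (≡-sym (ℕP.+-suc N d)) (s≤s (ℕP.m≤m+n N d))))
      j≡next+d : toℕ j ≡ toℕ (next i) + d
      j≡next+d = trans j≡i+d (trans (ℕP.+-suc (toℕ i) d) (cong (_+ d) (≡-sym (toℕ-next i i≢last))))

  everywhere : ∀ p → P p → ∀ j → P j
  everywhere p Pp j = climb (toℕ j) zero j refl P-zero
    where
      P-last : P (fromℕ N)
      P-last = climb (N ∸ toℕ p) p (fromℕ N)
        (trans (FP.toℕ-fromℕ N) (≡-sym (ℕP.m+[n∸m]≡n (ℕP.≤-pred (FP.toℕ<n p))))) Pp
      P-zero : P zero
      P-zero = subst P (next-last (fromℕ N) (≡-sym (FP.toℕ-fromℕ N))) (closed _ P-last)

exit-point : ∀ {N} {P : Fin (suc N) → Set} → (∀ i → Dec (P i)) → ∀ p q → P p → ¬ P q →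
             Σ[ i ∈ Fin (suc N) ] (P i × ¬ P (next i))
exit-point {P = P} P? p q Pp ¬Pq with any? (λ i → P? i ×-dec ¬? (P? (next i)))
... | yes exit = exit
... | no ¬exit = ⊥-elim (¬Pq (everywhere closed p Pp q))
  where closed : ∀ i → P i → P (next i)
        closed i Pi = decidable-stable (P? (next i)) (λ ¬Pnext → ¬exit (i , Pi , ¬Pnext))

module CycleFacts {t : ℕ} (T : Graph t) (k : ℕ) (c : Fin (suc (suc (suc k))) → Fin t)
                  (c-inj : ∀ i j → c i ≡ c j → i ≡ j)
                  (c-adj : ∀ (i : Fin (suc (suc k))) → adj T (c (inject₁ i)) (c (suc i)) ≡ true)
                  (c-close : adj T (c (fromℕ (suc (suc k)))) (c zero) ≡ true) where

  adj-next : ∀ i → adj T (c i) (c (next i)) ≡ true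
  adj-next i with suc (suc k) ℕ.≟ toℕ i
  ... | yes i-last = subst (λ z → adj T (c z) (c zero) ≡ true)
                           (FP.toℕ-injective (trans (FP.toℕ-fromℕ _) i-last)) c-close
  ... | no i≢last = subst (λ z → adj T (c z) (c (suc (lower₁ i i≢last))) ≡ true)
                          (FP.inject₁-lower₁ i i≢last) (c-adj (lower₁ i i≢last))

  -- Every vertex c (next j) of a cycle has the two distinct neighbours c j and
  -- c (next (next j)).
  not-leaf : ∀ j → ¬ IsLeaf T (c (next j))
  not-leaf j leaf = next²-≢ (s≤s (s≤s z≤n)) j (≡-sym (c-inj _ _ (leaf _ _ back forth)))
    where back : adj T (c (next j)) (c j) ≡ true
          back = trans (Graph.sym T _ _) (adj-next j)
          forth : adj T (c (next j)) (c (next (next j))) ≡ true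
          forth = adj-next (next j)

  no-bridge-crossing : (P : Fin t → Set) → (∀ y → Dec (P y)) → (a b : Fin t) →
    (∀ u w → P u → ¬ P w → adj T u w ≡ true → u ≡ a × w ≡ b) →
    ∀ p q → P (c p) → ¬ P (c q) → ⊥
  no-bridge-crossing P P? a b bridge p q Pp ¬Pq = next²-≢ (s≤s (s≤s z≤n)) j (trans (cong next (≡-sym i≡next-j)) next-i≡j)
    where
      out : Σ[ i ∈ _ ] (P (c i) × ¬ P (c (next i)))
      out = exit-point (λ i → P? (c i)) p q Pp ¬Pq
      back : Σ[ j ∈ _ ] (¬ P (c j) × ¬ ¬ P (c (next j)))
      back = exit-point (λ i → ¬? (P? (c i))) q p ¬Pq (λ ¬P → ¬P Pp)
      i j : Fin (suc (suc (suc k)))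
      i = proj₁ out
      j = proj₁ back
      out-edge : c i ≡ a × c (next i) ≡ b
      out-edge = bridge _ _ (proj₁ (proj₂ out)) (proj₂ (proj₂ out)) (adj-next i)
      back-edge : c (next j) ≡ a × c j ≡ b
      back-edge = bridge _ _ (decidable-stable (P? _) (proj₂ (proj₂ back))) (proj₁ (proj₂ back))
                         (trans (Graph.sym T _ _) (adj-next j))
      i≡next-j : i ≡ next j
      i≡next-j = c-inj _ _ (trans (proj₁ out-edge) (≡-sym (proj₁ back-edge)))
      next-i≡j : next i ≡ j
      next-i≡j = c-inj _ _ (trans (proj₂ out-edge) (≡-sym (proj₂ back-edge)))

-- Components of the two sides of a partition A, each with a canonical
-- representative (its first vertex) so that the components can be enumerated.

first-true : ∀ {n} → (Fin n → Bool) → Maybe (Fin n)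
first-true {zero} f = nothing
first-true {suc n} f with f zero
... | true  = just zero
... | false with first-true (f ∘ suc)
...   | just z  = just (suc z)
...   | nothing = nothing

first-true-cong : ∀ {n} (f g : Fin n → Bool) → (∀ y → f y ≡ g y) → first-true f ≡ first-true g
first-true-cong {zero} f g f≗g = refl
first-true-cong {suc n} f g f≗g with f zero | g zero | f≗g zero | first-true-cong (f ∘ suc) (g ∘ suc) (λ y → f≗g (suc y))
... | true  | true  | refl | _ = refl
... | false | false | refl | tail≡ with first-true (f ∘ suc) | first-true (g ∘ suc) | tail≡
...   | just z  | just .z | refl = refl
...   | nothing | nothing | refl = refl

first-true-found : ∀ {n} (f : Fin n → Bool) y → f y ≡ true → Σ[ z ∈ Fin n ] (first-true f ≡ just z × f z ≡ true)
first-true-found {suc n} f y fy with f zero in f0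
... | true = zero , refl , f0
... | false with y
...   | zero = ⊥-elim (not-¬ f0 fy)
...   | suc y' with first-true (f ∘ suc) | first-true-found (f ∘ suc) y' fy
...     | just z | .z , refl , fz = suc z , refl , fz

module Components {n : ℕ} (G : Graph n) (A : Fin n → Bool) where

  _∼_ : Fin n → Fin n → Set
  x ∼ y = Component G A (A x) x y

  side? : ∀ s y → Dec (A y ≡ s)
  side? s y = A y B.≟ s

  -- Deciding membership is expensive to unfold, and only its correctness matters.
  opaque
    _∼?_ : ∀ x y → Dec (x ∼ y)
    x ∼? y = side? (A x) y ×-dec reach? {G = G} (side? (A x)) x y

  ∼-side : ∀ {x y} → x ∼ y → A y ≡ A x
  ∼-side = proj₁

  ∼-refl : ∀ x → x ∼ x
  ∼-refl x = refl , reach-refl refl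

  ∼-sym : ∀ {x y} → x ∼ y → y ∼ x
  ∼-sym (y-side , R) = ≡-sym y-side , subst (λ s → Reach G (λ z → A z ≡ s) _ _) (≡-sym y-side) (reach-sym R)

  ∼-trans : ∀ {x y z} → x ∼ y → y ∼ z → x ∼ z
  ∼-trans (y-side , R) (z-side , R') =
    trans z-side y-side , reach-trans R (subst (λ s → Reach G (λ z → A z ≡ s) _ _) y-side R')

  ∼-step : ∀ {x y z} → x ∼ y → adj G y z ≡ true → A z ≡ A y → x ∼ z
  ∼-step (y-side , (l , W)) a z-side = trans z-side y-side , (suc l , walk-snoc W a (trans z-side y-side))

  in-comp : Fin n → Fin n → Bool
  in-comp x y = does (x ∼? y)

  opaque
    rep : Fin n → Fin n
    rep x = fromMaybe x (first-true (in-comp x))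

    rep-spec : ∀ x → Σ[ z ∈ Fin n ] (first-true (in-comp x) ≡ just z × rep x ≡ z × x ∼ z)
    rep-spec x with first-true (in-comp x) | first-true-found (in-comp x) x (dec-true (x ∼? x) (∼-refl x))
    ... | .(just z) | z , refl , in-z = z , refl , refl , true⇒holds (x ∼? z) in-z

    rep-∼ : ∀ x → x ∼ rep x
    rep-∼ x with rep-spec x
    ... | z , _ , rep≡z , x∼z = subst (x ∼_) (≡-sym rep≡z) x∼z

    rep-cong : ∀ {x y} → x ∼ y → rep x ≡ rep y
    rep-cong {x} {y} x∼y with rep-spec x | rep-spec y
    ... | z , first-x , rep-x , _ | z' , first-y , rep-y , _ =
      trans rep-x (trans (just-injective (trans (≡-sym first-x) (trans same-first first-y))) (≡-sym rep-y))
      where same-first : first-true (in-comp x) ≡ first-true (in-comp y)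
            same-first = first-true-cong (in-comp x) (in-comp y) λ z →
              does-⇔ (mk⇔ (∼-trans (∼-sym x∼y)) (∼-trans x∼y)) (x ∼? z) (y ∼? z)

  rep-idem : ∀ x → rep (rep x) ≡ rep x
  rep-idem x = ≡-sym (rep-cong (rep-∼ x))

  is-side : Bool → Fin n → Bool
  is-side s y = does (side? s y)

  edge-split-component : ∀ x (S : Fin n → Bool) → (∀ q → S q ≡ true → x ∼ q) →
    ∀ v w → S v ≡ true → S w ≡ false →
    adj G v w ≡ (in-comp x v ∧ (in-comp x w ∧ adj G v w)) xor (is-side (A x) v ∧ (not (is-side (A x) w) ∧ adj G v w))
  edge-split-component x S S⊆x v w Sv Sw with S⊆x v Sv
  ... | x∼v rewrite dec-true (x ∼? v) x∼v | dec-true (side? (A x) v) (∼-side x∼v) with x ∼? w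
  ...   | yes x∼w rewrite dec-true (side? (A x) w) (∼-side x∼w) = ≡-sym (xor-identityʳ _)
  ...   | no x≁w with side? (A x) w
  ...     | yes w-side = ¬-not (λ a → x≁w (∼-step x∼v a (trans w-side (≡-sym (∼-side x∼v)))))
  ...     | no _       = refl

  edge-split-side : ∀ s (S : Fin n → Bool) → (∀ q → S q ≡ true → A q ≡ s) → (∀ p q → p ∼ q → S p ≡ S q) →
    ∀ v w → S v ≡ true → S w ≡ false → adj G v w ≡ is-side s v ∧ (not (is-side s w) ∧ adj G v w)
  edge-split-side s S S⊆s S-comp v w Sv Sw rewrite dec-true (side? s v) (S⊆s v Sv) with side? s w
  ... | yes w-side = ¬-not (λ a → not-¬ Sv (trans (S-comp v w (∼-step (∼-refl v) a (trans w-side (≡-sym (S⊆s v Sv))))) Sw))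
  ... | no _       = refl

-- Cut-ranks over GF(2).  A rank bound is a spanning family for the rows of a
-- cut matrix; such families add up under XOR of matrices and survive masking.

⊕-cong : ∀ {k} {f g : Fin k → Bool} → (∀ i → f i ≡ g i) → ⊕-sum f ≡ ⊕-sum g
⊕-cong {zero}  f≗g = refl
⊕-cong {suc k} f≗g = cong₂ _xor_ (f≗g zero) (⊕-cong (λ i → f≗g (suc i)))

⊕-zero : ∀ {k} {f : Fin k → Bool} → (∀ i → f i ≡ false) → ⊕-sum f ≡ false
⊕-zero {zero}  f≗0 = refl
⊕-zero {suc k} {f} f≗0 = trans (cong (_xor ⊕-sum (f ∘ suc)) (f≗0 zero)) (⊕-zero (λ i → f≗0 (suc i)))

⊕-split : ∀ k₁ {k₂} (f : Fin (k₁ + k₂) → Bool) →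
          ⊕-sum f ≡ ⊕-sum (λ i → f (i ↑ˡ k₂)) xor ⊕-sum (λ i → f (k₁ ↑ʳ i))
⊕-split zero    f = refl
⊕-split (suc k₁) f = trans (cong (f zero xor_) (⊕-split k₁ (f ∘ suc))) (≡-sym (xor-assoc (f zero) _ _))

⊕-++ : ∀ {k₁ k₂} (c₁ b₁ : Fin k₁ → Bool) (c₂ b₂ : Fin k₂ → Bool) →
       ⊕-sum (λ i → (c₁ ++ c₂) i ∧ (b₁ ++ b₂) i) ≡
       ⊕-sum (λ i → c₁ i ∧ b₁ i) xor ⊕-sum (λ i → c₂ i ∧ b₂ i)
⊕-++ {k₁} c₁ b₁ c₂ b₂ = trans (⊕-split k₁ _)
  (cong₂ _xor_ (⊕-cong (λ i → cong₂ _∧_ (lookup-++ˡ c₁ c₂ i) (lookup-++ˡ b₁ b₂ i)))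
               (⊕-cong (λ i → cong₂ _∧_ (lookup-++ʳ c₁ c₂ i) (lookup-++ʳ b₁ b₂ i))))

module _ {n : ℕ} where

  RankOn : (Fin n → Fin n → Bool) → (Fin n → Bool) → ℕ → Set
  RankOn F S k = Σ[ b ∈ (Fin k → Fin n → Bool) ] ∀ v → S v ≡ true →
    Σ[ c ∈ (Fin k → Bool) ] ∀ w → S w ≡ false → F v w ≡ ⊕-sum (λ i → c i ∧ b i w)

  rank-xor : ∀ {F₁ F₂ k₁ k₂ S} → RankOn F₁ S k₁ → RankOn F₂ S k₂ →
             RankOn (λ v w → F₁ v w xor F₂ v w) S (k₁ + k₂)
  rank-xor (b₁ , h₁) (b₂ , h₂) = (λ i w → ((λ j → b₁ j w) ++ (λ j → b₂ j w)) i) , λ v Sv →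
    let (c₁ , e₁) = h₁ v Sv ; (c₂ , e₂) = h₂ v Sv in
    c₁ ++ c₂ , λ w Sw → trans (cong₂ _xor_ (e₁ w Sw) (e₂ w Sw)) (≡-sym (⊕-++ c₁ _ c₂ _))

  rank-mask : ∀ {k} (F : Fin n → Fin n → Bool) (S R C : Fin n → Bool) (b : Fin k → Fin n → Bool) →
    (∀ v → S v ≡ true → R v ≡ true →
       Σ[ c ∈ (Fin k → Bool) ] ∀ w → S w ≡ false → C w ≡ true → F v w ≡ ⊕-sum (λ i → c i ∧ b i w)) →
    RankOn (λ v w → R v ∧ (C w ∧ F v w)) S k
  rank-mask {k} F S R C b spans = (λ i w → b i w ∧ C w) , row
    where
      row : ∀ v → S v ≡ true →
            Σ[ c ∈ _ ] ∀ w → S w ≡ false → R v ∧ (C w ∧ F v w) ≡ ⊕-sum (λ i → c i ∧ (b i w ∧ C w))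
      row v Sv with R v in Rv
      ... | false = (λ _ → false) , λ w _ → ≡-sym (⊕-zero {k} (λ _ → refl))
      ... | true with spans v Sv Rv
      ...   | c , c-spans = c , col
        where
          col : ∀ w → S w ≡ false → C w ∧ F v w ≡ ⊕-sum (λ i → c i ∧ (b i w ∧ C w))
          col w Sw with C w in Cw
          ... | false = ≡-sym (⊕-zero (λ i → trans (cong (c i ∧_) (∧-zeroʳ (b i w))) (∧-zeroʳ (c i))))
          ... | true  = trans (c-spans w Sw Cw) (⊕-cong (λ i → cong (c i ∧_) (≡-sym (∧-identityʳ (b i w)))))

  module _ (G : Graph n) where

    cutrank-from-rank : ∀ {F S k} → RankOn F S k →
      (∀ v w → S v ≡ true → S w ≡ false → adj G v w ≡ F v w) → CutRankAtMost G All S k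
    cutrank-from-rank (b , h) adj≡F = b , λ v _ Sv → let (c , e) = h v Sv in
      c , λ w _ Sw → trans (adj≡F v w Sv Sw) (e w Sw)

    rank-of-cutrank : ∀ {X S k} → CutRankAtMost G X S k →
      (X? : ∀ v → Dec (X v)) → RankOn (λ v w → does (X? v) ∧ (does (X? w) ∧ adj G v w)) S k
    rank-of-cutrank {X} {S} (b , h) X? = rank-mask (adj G) S (does ∘ X?) (does ∘ X?) b λ v Sv Xv →
      let (c , e) = h v (true⇒holds (X? v) Xv) Sv in c , λ w Sw Xw → e w (true⇒holds (X? w) Xw) Sw

    cutrank-mono : ∀ {X S k k'} → k ≤ k' → CutRankAtMost G X S k → CutRankAtMost G X S k'
    cutrank-mono {X} {S} {k} {k'} k≤k' (b , h) = subst (CutRankAtMost G X S) (ℕP.m+[n∸m]≡n k≤k')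
      ((λ i w → ((λ j → b j w) ++ (λ _ → false)) i) , λ v Xv Sv → let (c , e) = h v Xv Sv in
        c ++ (λ _ → false) , λ w Xw Sw → trans (e w Xw Sw) (≡-sym (begin
          ⊕-sum (λ i → (c ++ _) i ∧ ((λ j → b j w) ++ _) i)
            ≡⟨ ⊕-++ c _ _ _ ⟩
          ⊕-sum (λ i → c i ∧ b i w) xor ⊕-sum {k' ∸ k} (λ _ → false)
            ≡⟨ cong (⊕-sum (λ i → c i ∧ b i w) xor_) (⊕-zero {k' ∸ k} (λ _ → refl)) ⟩
          ⊕-sum (λ i → c i ∧ b i w) xor false
            ≡⟨ xor-identityʳ _ ⟩
          ⊕-sum (λ i → c i ∧ b i w)
            ∎)))
      where open ≡-Reasoning

    cutrank-restrict : ∀ {X Y : Fin n → Set} → (∀ v → Y v → X v) → ∀ {S k} →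
                       CutRankAtMost G X S k → CutRankAtMost G Y S k
    cutrank-restrict Y⊆X (b , h) = b , λ v Yv Sv → let (c , e) = h v (Y⊆X v Yv) Sv in
      c , λ w Yw Sw → e w (Y⊆X w Yw) Sw

    cutrank-cong : ∀ {X S S' k} → (∀ v → S v ≡ S' v) → CutRankAtMost G X S k → CutRankAtMost G X S' k
    cutrank-cong S≗S' (b , h) = b , λ v Xv S'v → let (c , e) = h v Xv (trans (S≗S' v) S'v) in
      c , λ w Xw S'w → e w Xw (trans (S≗S' w) S'w)

    -- A set and its complement have the same cut-rank: transpose the
    -- factorisation, i.e. if the rows of the cut matrix are c_v · b then its
    -- columns are b · c_w.
    cutrank-complement : ∀ {S k} → CutRankAtMost G All S k → CutRankAtMost G All (not ∘ S) k
    cutrank-complement {S} {k} (b , h) = coef , λ v _ ¬Sv → (λ i → b i v) , λ w _ ¬Sw →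
      trans (Graph.sym G v w) (trans (coef-spans w (not-injective ¬Sw) v (not-injective ¬Sv))
                                     (⊕-cong (λ i → ∧-comm (coef i w) (b i v))))
      where
        coef : Fin k → Fin n → Bool
        coef i w with S w B.≟ true
        ... | yes Sw = proj₁ (h w tt Sw) i
        ... | no _   = false
        coef-spans : ∀ w → S w ≡ true → ∀ v → S v ≡ false → adj G w v ≡ ⊕-sum (λ i → coef i w ∧ b i v)
        coef-spans w Sw v Sv with S w B.≟ true
        ... | yes Sw' = proj₂ (h w tt Sw') v tt Sv
        ... | no ¬Sw = ⊥-elim (¬Sw Sw)

    rank-across : ∀ {P k} → CutRankAtMost G All P k → ∀ S →
                  RankOn (λ v w → P v ∧ (not (P w) ∧ adj G v w)) S k
    rank-across {P} (b , h) S = rank-mask (adj G) S P (not ∘ P) b λ v _ Pv →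
      let (c , e) = h v tt Pv in c , λ w _ ¬Pw → e w tt (not-injective ¬Pw)

    -- To bound the width of a node v of a decomposition of G it suffices to
    -- consider the unions of parts S with S p₀ = false for one fixed vertex
    -- p₀: the other unions are complements of these.
    width-from-complements : ∀ {t} (T : Graph t) (σ : Fin n → Fin t) v k (p₀ : Fin n) →
      (∀ S → (∀ i j → All i → All j → Reach T (λ y → ¬ y ≡ v) (σ i) (σ j) → S i ≡ S j) →
             S p₀ ≡ false → CutRankAtMost G All S k) →
      WidthAtMost G All T σ v k
    width-from-complements T σ v k p₀ bound S S-parts with S p₀ in Sp₀
    ... | false = bound S S-parts Sp₀
    ... | true  = cutrank-cong (λ w → not-involutive (S w))
                    (cutrank-complement (bound (not ∘ S) (λ i j Xi Xj R → cong not (S-parts i j Xi Xj R)) (cong not Sp₀)))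

    cutrank-no-edges : ∀ {S k} → (∀ v w → S v ≡ true → S w ≡ false → adj G v w ≡ false) → CutRankAtMost G All S k
    cutrank-no-edges {k = k} no-edges = (λ _ _ → false) , λ v _ Sv → (λ _ → false) , λ w _ Sw →
      trans (no-edges v w Sv Sw) (≡-sym (⊕-zero {k} (λ _ → refl)))

module _ {n : ℕ} (G : Graph n) where

  rankdepth-cong : ∀ {X Y : Fin n → Set} → (∀ v → X v → Y v) → (∀ v → Y v → X v) →
                   ∀ {m} → RankDepthAtMost G X m → RankDepthAtMost G Y m
  rankdepth-cong X⊆Y Y⊆X (inj₁ small) = inj₁ (λ x y Yx Yy → small x y (Y⊆X x Yx) (Y⊆X y Yy))
  rankdepth-cong X⊆Y Y⊆X (inj₂ (k , k≤m , t , T , σ , tree , σ-leaf , σ-inj , σ-onto , width , rad)) =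
    inj₂ (k , k≤m , t , T , σ , tree ,
          (λ x Yx → σ-leaf x (Y⊆X x Yx)) ,
          (λ x y Yx Yy → σ-inj x y (Y⊆X x Yx) (Y⊆X y Yy)) ,
          (λ l leaf → let (x , Xx , σx≡l) = σ-onto l leaf in x , X⊆Y x Xx , σx≡l) ,
          (λ v ¬leaf S S-const → cutrank-restrict G Y⊆X
             (width v ¬leaf S (λ i j Xi Xj → S-const i j (X⊆Y i Xi) (X⊆Y j Xj)))) ,
          rad)

  rankdepth-mono : ∀ {X m m'} → m ≤ m' → RankDepthAtMost G X m → RankDepthAtMost G X m'
  rankdepth-mono m≤m' (inj₁ small) = inj₁ small
  rankdepth-mono m≤m' (inj₂ (k , k≤m , D)) = inj₂ (k , ℕP.≤-trans k≤m m≤m' , D)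

-- A decomposition of G[X] of width and radius at most k ≤ m, with a root from
-- which every node is within distance k, such that a new neighbour can be
-- attached to the root without changing the set of leaves: the root is not a
-- leaf, or it has no neighbours at all.
record RootedDecomposition {n : ℕ} (G : Graph n) (X : Fin n → Set) (m : ℕ) : Set where
  field
    k               : ℕ
    k≤m             : k ≤ m
    t               : ℕ
    T               : Graph t
    σ               : Fin n → Fin t
    tree            : IsTree T
    σ-leaf          : ∀ x → X x → IsLeaf T (σ x)
    σ-inj           : ∀ x y → X x → X y → σ x ≡ σ y → x ≡ y
    σ-onto          : ∀ l → IsLeaf T l → Σ[ x ∈ Fin n ] (X x × σ x ≡ l)
    width           : ∀ v → ¬ IsLeaf T v → WidthAtMost G X T σ v k
    root            : Fin t
    radius          : ∀ z → Σ[ l ∈ ℕ ] (l ≤ k × Walk T All root z l)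
    root-attachable : ¬ IsLeaf T root ⊎ (∀ j → adj T root j ≡ false)

Point : Graph 1
Point = record { adj = λ _ _ → false ; sym = λ _ _ → refl ; irrefl = λ _ → refl }

point-unique : (i j : Fin 1) → i ≡ j
point-unique zero zero = refl

point-leaf : ∀ x → IsLeaf Point x
point-leaf x u w ()

point-walk : ∀ u w → Walk Point All u w 0
point-walk u w = subst (λ z → Walk Point All u z 0) (point-unique u w) (here tt)

point-tree : IsTree Point
point-tree = (λ u w → 0 , point-walk u w) , acyclic
  where acyclic : ¬ Cycle Point
        acyclic (k , c , c-inj , _) with c-inj zero (suc zero) (point-unique _ _)
        ... | ()

star-adj : Fin 3 → Fin 3 → Bool
star-adj zero    zero    = false
star-adj zero    (suc _) = true
star-adj (suc _) zero    = true
star-adj (suc _) (suc _) = false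

Star : Graph 3
Star = record { adj = star-adj ; sym = symmetric ; irrefl = λ { zero → refl ; (suc _) → refl } }
  where symmetric : ∀ u v → star-adj u v ≡ star-adj v u
        symmetric zero    zero    = refl
        symmetric zero    (suc _) = refl
        symmetric (suc _) zero    = refl
        symmetric (suc _) (suc _) = refl

star-leaf : ∀ i → IsLeaf Star (suc i)
star-leaf i zero    zero    _ _ = refl
star-leaf i zero    (suc _) _ ()
star-leaf i (suc _) _       () _

star-centre : ¬ IsLeaf Star zero
star-centre leaf with leaf (suc zero) (suc (suc zero)) refl refl
... | ()

star-radius : ∀ z → Σ[ l ∈ ℕ ] (l ≤ 1 × Walk Star All zero z l)
star-radius zero    = 0 , z≤n , here tt
star-radius (suc i) = 1 , s≤s z≤n , step tt refl (here tt)

-- A cycle has no leaves, but the second and third vertex of a cycle in the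
-- star cannot both be its centre.
star-tree : IsTree Star
star-tree = connected , acyclic
  where
    connected : Connected Star
    connected u w = reach-trans (reach-sym (_ , proj₂ (proj₂ (star-radius u)))) (_ , proj₂ (proj₂ (star-radius w)))
    on-cycle-centre : ∀ {k} (c : Fin (suc (suc (suc k))) → Fin 3) j → ¬ IsLeaf Star (c j) → c j ≡ zero
    on-cycle-centre c j ¬leaf with c j
    ... | zero  = refl
    ... | suc i = ⊥-elim (¬leaf (star-leaf i))
    acyclic : ¬ Cycle Star
    acyclic (k , c , c-inj , c-adj , c-close) with
      c-inj (suc zero) (suc (suc zero))
        (trans (on-cycle-centre c (suc zero) (not-leaf zero))
               (≡-sym (on-cycle-centre c (suc (suc zero)) (not-leaf (suc zero)))))
      where open CycleFacts Star k c c-inj c-adj c-close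
    ... | ()

module _ {n : ℕ} (G : Graph n) {X : Fin n → Set} where

  -- Any cut of a vertex set with at most two vertices p, q has rank at most 1:
  -- the row of v is a multiple of the single vector of ones.
  cutrank-pair : (p q : Fin n) → (∀ y → X y → y ≡ p ⊎ y ≡ q) → ∀ S → CutRankAtMost G X S 1
  cutrank-pair p q X⊆pq S = (λ _ _ → true) , λ v Xv Sv → (λ _ → adj G v (other v)) , λ w Xw Sw →
    trans (cong (adj G v) (other-spec v w Xv Xw (λ v≡w → not-¬ Sv (trans (cong S v≡w) Sw))))
          (≡-sym (trans (xor-identityʳ _) (∧-identityʳ _)))
    where
      other : Fin n → Fin n
      other v with v F.≟ p
      ... | yes _ = q
      ... | no _  = p
      other-spec : ∀ v w → X v → X w → v ≢ w → w ≡ other v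
      other-spec v w Xv Xw v≢w with v F.≟ p | X⊆pq w Xw
      ... | yes v≡p | inj₁ w≡p = ⊥-elim (v≢w (trans v≡p (≡-sym w≡p)))
      ... | yes _   | inj₂ w≡q = w≡q
      ... | no _    | inj₁ w≡p = w≡p
      ... | no v≢p  | inj₂ w≡q with X⊆pq v Xv
      ...   | inj₁ v≡p = ⊥-elim (v≢p v≡p)
      ...   | inj₂ v≡q = ⊥-elim (v≢w (trans v≡q (≡-sym w≡q)))

  point-decomposition : ∀ {m} (x₀ : Fin n) → X x₀ → (∀ x y → X x → X y → x ≡ y) → RootedDecomposition G X m
  point-decomposition x₀ Xx₀ small = record
    { k = 0 ; k≤m = z≤n ; t = 1 ; T = Point ; σ = λ _ → zero ; tree = point-tree
    ; σ-leaf = λ _ _ → point-leaf zero ; σ-inj = λ x y Xx Xy _ → small x y Xx Xy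
    ; σ-onto = λ l _ → x₀ , Xx₀ , point-unique _ _
    ; width = λ v ¬leaf → ⊥-elim (¬leaf (point-leaf v))
    ; root = zero ; radius = λ z → 0 , z≤n , point-walk zero z
    ; root-attachable = inj₂ (λ _ → refl) }

  pair-decomposition : ∀ {m} → 1 ≤ m → (p q : Fin n) → p ≢ q → X p → X q →
                       (∀ y → X y → y ≡ p ⊎ y ≡ q) → RootedDecomposition G X m
  pair-decomposition 1≤m p q p≢q Xp Xq X⊆pq = record
    { k = 1 ; k≤m = 1≤m ; t = 3 ; T = Star ; σ = σ ; tree = star-tree
    ; σ-leaf = λ y _ → σ-leaf y ; σ-inj = σ-inj ; σ-onto = σ-onto
    ; width = λ _ _ S _ → cutrank-pair p q X⊆pq S
    ; root = zero ; radius = star-radius ; root-attachable = inj₁ star-centre }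
    where
      σ : Fin n → Fin 3
      σ y with y F.≟ p
      ... | yes _ = suc zero
      ... | no _  = suc (suc zero)
      σ-leaf : ∀ y → IsLeaf Star (σ y)
      σ-leaf y with y F.≟ p
      ... | yes _ = star-leaf zero
      ... | no _  = star-leaf (suc zero)
      σ-p : σ p ≡ suc zero
      σ-p with p F.≟ p
      ... | yes _   = refl
      ... | no p≢p = ⊥-elim (p≢p refl)
      σ-q : σ q ≡ suc (suc zero)
      σ-q with q F.≟ p
      ... | yes q≡p = ⊥-elim (p≢q (≡-sym q≡p))
      ... | no _    = refl
      σ-inj : ∀ x y → X x → X y → σ x ≡ σ y → x ≡ y
      σ-inj x y Xx Xy σx≡σy with X⊆pq x Xx | X⊆pq y Xy
      ... | inj₁ refl | inj₁ refl = refl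
      ... | inj₂ refl | inj₂ refl = refl
      ... | inj₁ refl | inj₂ refl with trans (≡-sym σ-p) (trans σx≡σy σ-q)
      ...   | ()
      σ-inj x y Xx Xy σx≡σy | inj₂ refl | inj₁ refl with trans (≡-sym σ-q) (trans σx≡σy σ-p)
      ...   | ()
      σ-onto : ∀ l → IsLeaf Star l → Σ[ x ∈ Fin n ] (X x × σ x ≡ l)
      σ-onto zero             leaf = ⊥-elim (star-centre leaf)
      σ-onto (suc zero)       _    = p , Xp , σ-p
      σ-onto (suc (suc zero)) _    = q , Xq , σ-q

leaf? : ∀ {t} (T : Graph t) x → Dec (IsLeaf T x)
leaf? T x = all? λ u → all? λ w → (adj T x u B.≟ true) →-dec ((adj T x w B.≟ true) →-dec (u F.≟ w))

module _ {n : ℕ} (G : Graph n) {X : Fin n → Set} {m : ℕ} (1≤m : 1 ≤ m) where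

  module Reroot (k : ℕ) (k≤m : k ≤ m) (t : ℕ) (T : Graph t) (σ : Fin n → Fin t) (tree : IsTree T)
                (σ-leaf : ∀ x → X x → IsLeaf T (σ x))
                (σ-inj : ∀ x y → X x → X y → σ x ≡ σ y → x ≡ y)
                (σ-onto : ∀ l → IsLeaf T l → Σ[ x ∈ Fin n ] (X x × σ x ≡ l))
                (width : ∀ v → ¬ IsLeaf T v → WidthAtMost G X T σ v k)
                (c : Fin t) (radius : ∀ z → Σ[ l ∈ ℕ ] (l ≤ k × Walk T All c z l)) where

    rooted-at : (r : Fin t) → (∀ z → Σ[ l ∈ ℕ ] (l ≤ k × Walk T All r z l)) →
                ¬ IsLeaf T r ⊎ (∀ j → adj T r j ≡ false) → RootedDecomposition G X m
    rooted-at r radius-r attachable = record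
      { k = k ; k≤m = k≤m ; t = t ; T = T ; σ = σ ; tree = tree ; σ-leaf = σ-leaf ; σ-inj = σ-inj
      ; σ-onto = σ-onto ; width = width ; root = r ; radius = radius-r ; root-attachable = attachable }

    module LeafCentre (c-leaf : IsLeaf T c) (u : Fin t) (cu : adj T c u ≡ true) where
      -- Since c ≠ u, the radius bound k is at least 1.
      c≢u : c ≢ u
      c≢u refl = not-¬ cu (Graph.irrefl T c)

      1≤k : 1 ≤ k
      1≤k with radius u
      ... | zero  , _   , here _ = ⊥-elim (c≢u refl)
      ... | suc l , l<k , _      = ℕP.≤-trans (s≤s z≤n) l<k

      -- Every walk from c starts with the edge cu, so u is a centre as well.
      radius-u : ∀ z → Σ[ l ∈ ℕ ] (l ≤ k × Walk T All u z l)
      radius-u z with radius z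
      ... | .0 , _ , here _ = 1 , 1≤k , step tt (trans (Graph.sym T u c) cu) (here tt)
      ... | suc l , l<k , step {v = v} _ cv W =
        l , ℕP.≤-trans (ℕP.n≤1+n l) l<k , subst (λ y → Walk T All y z l) (c-leaf v u cv cu) W

      -- If u is a leaf too, T is the single edge cu and X has exactly two vertices.
      module TwoLeaves (u-leaf : IsLeaf T u) where
        on-edge : ∀ {y z l} → y ≡ c ⊎ y ≡ u → Walk T All y z l → z ≡ c ⊎ z ≡ u
        on-edge y∈cu (here _) = y∈cu
        on-edge (inj₁ refl) (step _ a W) = on-edge (inj₂ (c-leaf _ _ a cu)) W
        on-edge (inj₂ refl) (step _ a W) = on-edge (inj₁ (u-leaf _ _ a (trans (Graph.sym T u c) cu))) W

        p : Σ[ x ∈ Fin n ] (X x × σ x ≡ c)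
        p = σ-onto c c-leaf
        q : Σ[ x ∈ Fin n ] (X x × σ x ≡ u)
        q = σ-onto u u-leaf

        X⊆pq : ∀ y → X y → y ≡ proj₁ p ⊎ y ≡ proj₁ q
        X⊆pq y Xy with on-edge (inj₁ refl) (proj₂ (proj₂ (radius (σ y))))
        ... | inj₁ σy≡c = inj₁ (σ-inj y _ Xy (proj₁ (proj₂ p)) (trans σy≡c (≡-sym (proj₂ (proj₂ p)))))
        ... | inj₂ σy≡u = inj₂ (σ-inj y _ Xy (proj₁ (proj₂ q)) (trans σy≡u (≡-sym (proj₂ (proj₂ q)))))

        result : RootedDecomposition G X m
        result = pair-decomposition G 1≤m (proj₁ p) (proj₁ q)
          (λ p≡q → c≢u (trans (≡-sym (proj₂ (proj₂ p))) (trans (cong σ p≡q) (proj₂ (proj₂ q)))))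
          (proj₁ (proj₂ p)) (proj₁ (proj₂ q)) X⊆pq

      result : RootedDecomposition G X m
      result with leaf? T u
      ... | no ¬u-leaf = rooted-at u radius-u (inj₁ ¬u-leaf)
      ... | yes u-leaf = TwoLeaves.result u-leaf

    result : RootedDecomposition G X m
    result with leaf? T c
    ... | no ¬c-leaf = rooted-at c radius (inj₁ ¬c-leaf)
    ... | yes c-leaf with any? (λ j → adj T c j B.≟ true)
    ...   | no isolated = rooted-at c radius (inj₂ (λ j → ¬-not (λ cj → isolated (j , cj))))
    ...   | yes (u , cu) = LeafCentre.result c-leaf u cu

  rooted-decomposition : ∀ x₀ → X x₀ → RankDepthAtMost G X m → RootedDecomposition G X m
  rooted-decomposition x₀ Xx₀ (inj₁ small) = point-decomposition G x₀ Xx₀ small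
  rooted-decomposition x₀ Xx₀ (inj₂ (k , k≤m , t , T , σ , tree , σ-leaf , σ-inj , σ-onto , width , c , radius)) =
    Reroot.result k k≤m t T σ tree σ-leaf σ-inj σ-onto width c radius

-- Fin (ΣF f) is the disjoint union of the sets Fin (f x), x : Fin n.
ΣF : ∀ {n} → (Fin n → ℕ) → ℕ
ΣF {zero}  f = 0
ΣF {suc n} f = f zero + ΣF (f ∘ suc)

inΣ : ∀ {n} (f : Fin n → ℕ) (x : Fin n) → Fin (f x) → Fin (ΣF f)
inΣ f zero    j = j ↑ˡ _
inΣ f (suc x) j = f zero ↑ʳ inΣ (f ∘ suc) x j

outΣ : ∀ {n} (f : Fin n → ℕ) → Fin (ΣF f) → Σ[ x ∈ Fin n ] Fin (f x)
outΣ {suc n} f i with splitAt (f zero) i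
... | inj₁ j = zero , j
... | inj₂ i' with outΣ (f ∘ suc) i'
...   | x , j = suc x , j

outΣ-inΣ : ∀ {n} (f : Fin n → ℕ) x j → outΣ f (inΣ f x j) ≡ (x , j)
outΣ-inΣ {suc n} f zero j rewrite FP.splitAt-↑ˡ (f zero) j (ΣF (f ∘ suc)) = refl
outΣ-inΣ {suc n} f (suc x) j rewrite FP.splitAt-↑ʳ (f zero) (ΣF (f ∘ suc)) (inΣ (f ∘ suc) x j)
                                   | outΣ-inΣ (f ∘ suc) x j = refl

inΣ-outΣ : ∀ {n} (f : Fin n → ℕ) i → inΣ f (proj₁ (outΣ f i)) (proj₂ (outΣ f i)) ≡ i
inΣ-outΣ {suc n} f i with splitAt (f zero) i in split≡
... | inj₁ j = FP.splitAt⁻¹-↑ˡ split≡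
... | inj₂ i' with outΣ (f ∘ suc) i' | inΣ-outΣ (f ∘ suc) i'
...   | x , j | inΣ≡i' = trans (cong (f zero ↑ʳ_) inΣ≡i') (FP.splitAt⁻¹-↑ʳ split≡)

-- The disjoint union of the sets Fin (t x) over those x satisfying a
-- decidable, proof-irrelevant predicate P, encoded as Fin total.
module DisjointUnion {n : ℕ} {P : Fin n → Set} (P? : ∀ x → Dec (P x))
                     (P-irrelevant : ∀ {x} (p q : P x) → p ≡ q) (t : Fin n → ℕ) where

  Part : Set
  Part = Σ[ x ∈ Fin n ] (P x × Fin (t x))

  size-if : ∀ {Q : Set} → Dec Q → ℕ → ℕ
  size-if (yes _) s = s
  size-if (no _)  _ = 0

  into : ∀ {Q : Set} {s} (Q? : Dec Q) → Q → Fin s → Fin (size-if Q? s)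
  into (yes _) _ j = j
  into (no ¬q) q _ = ⊥-elim (¬q q)

  out-of : ∀ {Q : Set} {s} (Q? : Dec Q) → Fin (size-if Q? s) → Q × Fin s
  out-of (yes q) j = q , j

  out-of-into : ∀ {Q : Set} {s} (Q? : Dec Q) (q : Q) (j : Fin s) → proj₂ (out-of Q? (into Q? q j)) ≡ j
  out-of-into (yes _) _ _ = refl
  out-of-into (no ¬q) q _ = ⊥-elim (¬q q)

  into-out-of : ∀ {Q : Set} {s} (Q? : Dec Q) (j : Fin (size-if Q? s)) →
                into Q? (proj₁ (out-of Q? j)) (proj₂ (out-of Q? j)) ≡ j
  into-out-of (yes _) _ = refl

  opaque
    size : Fin n → ℕ
    size x = size-if (P? x) (t x)

    total : ℕ
    total = ΣF size

    inject : Part → Fin total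
    inject (x , p , j) = inΣ size x (into (P? x) p j)

    project : Fin total → Part
    project i = proj₁ (outΣ size i) , out-of (P? _) (proj₂ (outΣ size i))

    project-inject : ∀ x p j → project (inject (x , p , j)) ≡ (x , p , j)
    project-inject x p j rewrite outΣ-inΣ size x (into (P? x) p j) =
      cong (x ,_) (cong₂ _,_ (P-irrelevant _ p) (out-of-into (P? x) p j))

    inject-project : ∀ i → inject (project i) ≡ i
    inject-project i = trans (cong (inΣ size (proj₁ (outΣ size i))) (into-out-of (P? _) _)) (inΣ-outΣ size i)

-- Given rooted decompositions of all components of G[A] and G[A̅], build one
-- tree: two adjacent hubs, one for each side, and for every component of side
-- s a copy of its tree whose root is joined to the hub of side s.
module Glue {n : ℕ} (G : Graph n) (A : Fin n → Bool) (m : ℕ)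
            (D : ∀ x → RootedDecomposition G (Components._∼_ G A x) m) where

  open Components G A
  module Block (x : Fin n) = RootedDecomposition (D x)

  -- Only representatives contribute a block, one per component.
  IsRep : Fin n → Set
  IsRep x = rep x ≡ x

  fin-irrelevant : ∀ {a b : Fin n} (p q : a ≡ b) → p ≡ q
  fin-irrelevant = Decidable⇒UIP.≡-irrelevant F._≟_

  data Node : Set where
    hub : Bool → Node
    blk : (x : Fin n) → IsRep x → Fin (Block.t x) → Node

  open DisjointUnion (λ x → rep x F.≟ x) fin-irrelevant Block.t using (total; inject; project; project-inject; inject-project)

  N : ℕ
  N = suc (suc total)

  code : Node → Fin N
  code (hub true)  = zero
  code (hub false) = suc zero
  code (blk x r j) = suc (suc (inject (x , r , j)))

  node : Fin N → Node
  node zero           = hub true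
  node (suc zero)     = hub false
  node (suc (suc i)) = blk (proj₁ (project i)) (proj₁ (proj₂ (project i))) (proj₂ (proj₂ (project i)))

  node-code : ∀ v → node (code v) ≡ v
  node-code (hub true)  = refl
  node-code (hub false) = refl
  node-code (blk x r j) = cong (λ p → blk (proj₁ p) (proj₁ (proj₂ p)) (proj₂ (proj₂ p))) (project-inject x r j)

  code-node : ∀ i → code (node i) ≡ i
  code-node zero          = refl
  code-node (suc zero)    = refl
  code-node (suc (suc i)) = cong (λ i → suc (suc i)) (inject-project i)

  node-injective : ∀ {i i'} → node i ≡ node i' → i ≡ i'
  node-injective {i} {i'} eq = trans (≡-sym (code-node i)) (trans (cong code eq) (code-node i'))

  blk-rep-irrelevant : ∀ x (r r' : IsRep x) j → blk x r j ≡ blk x r' j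
  blk-rep-irrelevant x r r' j = cong (λ r → blk x r j) (fin-irrelevant r r')

  is-root : ∀ x → Fin (Block.t x) → Bool
  is-root x j = does (j F.≟ Block.root x)

  block-adj : ∀ x y → Dec (x ≡ y) → Fin (Block.t x) → Fin (Block.t y) → Bool
  block-adj x .x (yes refl) j j' = adj (Block.T x) j j'
  block-adj x y  (no _)     _ _  = false

  node-adj : Node → Node → Bool
  node-adj (hub s)     (hub s')     = s xor s'
  node-adj (hub s)     (blk x _ j)  = is-side s x ∧ is-root x j
  node-adj (blk x _ j) (hub s)      = is-side s x ∧ is-root x j
  node-adj (blk x _ j) (blk y _ j') = block-adj x y (x F.≟ y) j j'

  block-adj-same : ∀ x (x≟x : Dec (x ≡ x)) j j' → block-adj x x x≟x j j' ≡ adj (Block.T x) j j'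
  block-adj-same x (yes x≡x) j j' rewrite fin-irrelevant x≡x refl = refl
  block-adj-same x (no x≢x) _ _ = ⊥-elim (x≢x refl)

  block-adj-sym : ∀ x y (x≟y : Dec (x ≡ y)) (y≟x : Dec (y ≡ x)) j j' →
                  block-adj x y x≟y j j' ≡ block-adj y x y≟x j' j
  block-adj-sym x .x (yes refl) y≟x j j' = trans (Graph.sym (Block.T x) j j') (≡-sym (block-adj-same x y≟x j' j))
  block-adj-sym x y (no x≢y) (yes refl) _ _ = ⊥-elim (x≢y refl)
  block-adj-sym x y (no _)   (no _)     _ _ = refl

  node-adj-sym : ∀ u v → node-adj u v ≡ node-adj v u
  node-adj-sym (hub s)     (hub s')     = xor-comm s s'
  node-adj-sym (hub s)     (blk x _ j)  = refl
  node-adj-sym (blk x _ j) (hub s)      = refl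
  node-adj-sym (blk x _ j) (blk y _ j') = block-adj-sym x y (x F.≟ y) (y F.≟ x) j j'

  node-adj-irrefl : ∀ v → node-adj v v ≡ false
  node-adj-irrefl (hub s)     = xor-same s
  node-adj-irrefl (blk x _ j) = trans (block-adj-same x (x F.≟ x) j j) (Graph.irrefl (Block.T x) j)

  GT : Graph N
  GT = record { adj = λ i i' → node-adj (node i) (node i')
              ; sym = λ i i' → node-adj-sym (node i) (node i')
              ; irrefl = λ i → node-adj-irrefl (node i) }

  adj-code : ∀ u i → adj GT (code u) i ≡ node-adj u (node i)
  adj-code u i = cong (λ v → node-adj v (node i)) (node-code u)

  adj-codes : ∀ u v → adj GT (code u) (code v) ≡ node-adj u v
  adj-codes u v = trans (adj-code u (code v)) (cong (node-adj u) (node-code v))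

  adj-in-block : ∀ x r r' j j' → node-adj (blk x r j) (blk x r' j') ≡ adj (Block.T x) j j'
  adj-in-block x r r' j j' = block-adj-same x (x F.≟ x) j j'

  adj-hub-root : ∀ x r → node-adj (hub (A x)) (blk x r (Block.root x)) ≡ true
  adj-hub-root x r = cong₂ _∧_ (dec-true (side? (A x) x) refl) (dec-true (Block.root x F.≟ Block.root x) refl)

  adj-hub-hub : ∀ s → node-adj (hub s) (hub (not s)) ≡ true
  adj-hub-hub s = xor-inverseʳ s

  block-neighbour : ∀ x r j v → node-adj (blk x r j) v ≡ true →
    (v ≡ hub (A x) × j ≡ Block.root x) ⊎ Σ[ j' ∈ Fin (Block.t x) ] (v ≡ blk x r j' × adj (Block.T x) j j' ≡ true)
  block-neighbour x r j (hub s) a with ∧-conicalˡ _ _ a | ∧-conicalʳ _ _ a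
  ... | side | root = inj₁ (cong hub (≡-sym (true⇒holds (side? s x) side)) , true⇒holds (j F.≟ _) root)
  block-neighbour x r j (blk y r' j') a with x F.≟ y
  ... | yes refl = inj₂ (j' , blk-rep-irrelevant x r' r j' , a)

  lift-walk : ∀ x r {Y : Fin (Block.t x) → Set} {Z : Fin N → Set} → (∀ j → Y j → Z (code (blk x r j))) →
              ∀ {j j' l} → Walk (Block.T x) Y j j' l → Walk GT Z (code (blk x r j)) (code (blk x r j')) l
  lift-walk x r Y⇒Z (here y)     = here (Y⇒Z _ y)
  lift-walk x r Y⇒Z (step {j₁} {j₂} y a W) =
    step (Y⇒Z _ y) (trans (adj-codes (blk x r j₁) (blk x r j₂)) (trans (adj-in-block x r r j₁ j₂) a)) (lift-walk x r Y⇒Z W)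

  from-root : ∀ x r {Z : Fin N → Set} → (∀ j → Z (code (blk x r j))) → ∀ j →
              Σ[ l ∈ ℕ ] (l ≤ m × Walk GT Z (code (blk x r (Block.root x))) (code (blk x r j)) l)
  from-root x r Z-block j with Block.radius x j
  ... | l , l≤k , W = l , ℕP.≤-trans l≤k (Block.k≤m x) , lift-walk x r (λ j _ → Z-block j) W

  within-block : ∀ x r {Z : Fin N → Set} → (∀ j → Z (code (blk x r j))) → ∀ j j' →
                 Reach GT Z (code (blk x r j)) (code (blk x r j'))
  within-block x r Z-block j j' = reach-trans (reach-sym (_ , proj₂ (proj₂ (from-root x r Z-block j))))
                                              (_ , proj₂ (proj₂ (from-root x r Z-block j')))

  hub-to-hub : ∀ {Z : Fin N → Set} s s' → Z (code (hub s)) → Z (code (hub s')) → Reach GT Z (code (hub s)) (code (hub s'))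
  hub-to-hub true  true  z _  = reach-refl z
  hub-to-hub false false z _  = reach-refl z
  hub-to-hub true  false z z' = 1 , step z refl (here z')
  hub-to-hub false true  z z' = 1 , step z refl (here z')

  radius : ∀ i → Σ[ l ∈ ℕ ] (l ≤ suc (suc m) × Walk GT All (code (hub true)) i l)
  radius i = subst (λ i → Σ[ l ∈ ℕ ] (l ≤ suc (suc m) × Walk GT All (code (hub true)) i l)) (code-node i) (to (node i))
    where
      to-hub : ∀ s → Σ[ l ∈ ℕ ] (l ≤ 1 × Walk GT All (code (hub true)) (code (hub s)) l)
      to-hub true  = 0 , z≤n , here tt
      to-hub false = 1 , s≤s z≤n , step tt refl (here tt)
      to : ∀ v → Σ[ l ∈ ℕ ] (l ≤ suc (suc m) × Walk GT All (code (hub true)) (code v) l)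
      to (hub s) with to-hub s
      ... | l , l≤1 , W = l , ℕP.≤-trans l≤1 (s≤s z≤n) , W
      to (blk x r j) with to-hub (A x) | from-root x r {All} (λ _ → tt) j
      ... | l , l≤1 , W | l' , l'≤m , W' =
        l + suc l' , ℕP.+-mono-≤ l≤1 (s≤s l'≤m) ,
        walk-++ W (step tt (trans (adj-codes (hub (A x)) (blk x r (Block.root x))) (adj-hub-root x r)) W')

  connected : Connected GT
  connected u w = reach-trans (reach-sym (_ , proj₂ (proj₂ (radius u)))) (_ , proj₂ (proj₂ (radius w)))

  -- A cycle through a node of block x stays inside the block,
  -- since the only edge leaving it joins its root to a hub; so it is a cycle of
  -- the tree of x.
  in-block : Fin n → Node → Set
  in-block x (hub _)     = ⊥
  in-block x (blk y _ _) = x ≡ y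

  in-block? : ∀ x v → Dec (in-block x v)
  in-block? x (hub _)     = no λ ()
  in-block? x (blk y _ _) = x F.≟ y

  position : ∀ x v → in-block x v → Fin (Block.t x)
  position x (blk .x _ j) refl = j

  position-spec : ∀ x r v (v∈x : in-block x v) → v ≡ blk x r (position x v v∈x)
  position-spec x r (blk .x r' j) refl = blk-rep-irrelevant x r' r j

  leaving-block : ∀ x r u w → in-block x u → ¬ in-block x w → node-adj u w ≡ true →
                  u ≡ blk x r (Block.root x) × w ≡ hub (A x)
  leaving-block x r (blk .x r' j) w refl w∉x a with block-neighbour x r' j w a
  ... | inj₁ (refl , refl) = blk-rep-irrelevant x r' r _ , refl
  ... | inj₂ (j' , refl , _) = ⊥-elim (w∉x refl)

  IsBlockNode : Node → Set
  IsBlockNode (hub _)     = ⊥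
  IsBlockNode (blk _ _ _) = ⊤

  block-node? : ∀ v → Dec (IsBlockNode v)
  block-node? (hub _)     = no λ ()
  block-node? (blk _ _ _) = yes tt

  module GluedCycle (k : ℕ) (c : Fin (suc (suc (suc k))) → Fin N) (c-inj : ∀ i j → c i ≡ c j → i ≡ j)
                    (c-adj : ∀ (i : Fin (suc (suc k))) → adj GT (c (inject₁ i)) (c (suc i)) ≡ true)
                    (c-close : adj GT (c (fromℕ (suc (suc k)))) (c zero) ≡ true) where
    open CycleFacts GT k c c-inj c-adj c-close

    through-block : ∀ p → IsBlockNode (node (c p)) → ⊥
    through-block p p-block with node (c p) in c-p
    ... | blk x r j = proj₂ (Block.tree x) (k , c' , c'-inj , c'-adj , c'-close)
      where
        bridge : ∀ u w → in-block x (node u) → ¬ in-block x (node w) → adj GT u w ≡ true →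
                 u ≡ code (blk x r (Block.root x)) × w ≡ code (hub (A x))
        bridge u w u∈x w∉x a with leaving-block x r (node u) (node w) u∈x w∉x a
        ... | u≡root , w≡hub = node-injective (trans u≡root (≡-sym (node-code _))) ,
                                node-injective (trans w≡hub (≡-sym (node-code _)))
        inside : ∀ q → in-block x (node (c q))
        inside q = decidable-stable (in-block? x _) λ outside →
          no-bridge-crossing (λ u → in-block x (node u)) (λ u → in-block? x (node u)) _ _ bridge p q
            (subst (in-block x) (≡-sym c-p) refl) outside
        c' : Fin (suc (suc (suc k))) → Fin (Block.t x)
        c' q = position x (node (c q)) (inside q)
        c-in-block : ∀ q → node (c q) ≡ blk x r (c' q)
        c-in-block q = position-spec x r (node (c q)) (inside q)
        c'-inj : ∀ q q' → c' q ≡ c' q' → q ≡ q'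
        c'-inj q q' eq = c-inj q q' (node-injective (trans (c-in-block q) (trans (cong (blk x r) eq) (≡-sym (c-in-block q')))))
        project-adj : ∀ q q' → adj GT (c q) (c q') ≡ true → adj (Block.T x) (c' q) (c' q') ≡ true
        project-adj q q' a = trans (≡-sym (adj-in-block x r r _ _)) (trans (≡-sym (cong₂ node-adj (c-in-block q) (c-in-block q'))) a)
        c'-adj : ∀ i → adj (Block.T x) (c' (inject₁ i)) (c' (suc i)) ≡ true
        c'-adj i = project-adj _ _ (c-adj i)
        c'-close : adj (Block.T x) (c' (fromℕ (suc (suc k)))) (c' zero) ≡ true
        c'-close = project-adj _ _ c-close

    -- A cycle avoiding all blocks would have three distinct vertices on the
    -- two hubs.
    hubs-only : (∀ q → ¬ IsBlockNode (node (c q))) → ⊥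
    hubs-only no-block = distinct (two-of-three (side zero) (side (suc zero)) (side (suc (suc zero))))
      where
        on-hub : ∀ q → Σ[ s ∈ Bool ] node (c q) ≡ hub s
        on-hub q with node (c q) | no-block q
        ... | hub s     | _       = s , refl
        ... | blk _ _ _ | ¬block = ⊥-elim (¬block tt)
        side : Fin (suc (suc (suc k))) → Bool
        side q = proj₁ (on-hub q)
        same-side : ∀ q q' → side q ≡ side q' → q ≡ q'
        same-side q q' eq = c-inj q q' (node-injective (trans (proj₂ (on-hub q)) (trans (cong hub eq) (≡-sym (proj₂ (on-hub q'))))))
        distinct : side zero ≡ side (suc zero) ⊎ side zero ≡ side (suc (suc zero)) ⊎
                   side (suc zero) ≡ side (suc (suc zero)) → ⊥
        distinct (inj₁ eq) with same-side _ _ eq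
        ... | ()
        distinct (inj₂ (inj₁ eq)) with same-side _ _ eq
        ... | ()
        distinct (inj₂ (inj₂ eq)) with same-side _ _ eq
        ... | ()

  acyclic : ¬ Cycle GT
  acyclic (k , c , c-inj , c-adj , c-close) with any? (λ q → block-node? (node (c q)))
  ... | yes (p , p-block) = GluedCycle.through-block k c c-inj c-adj c-close p p-block
  ... | no no-block       = GluedCycle.hubs-only k c c-inj c-adj c-close (λ q block → no-block (q , block))

  tree : IsTree GT
  tree = connected , acyclic

  leaf-of : Fin n → Fin N
  leaf-of p = code (blk (rep p) (rep-idem p) (Block.σ (rep p) p))

  rep-of : ∀ {x p} → IsRep x → x ∼ p → rep p ≡ x
  rep-of x-rep x∼p = trans (≡-sym (rep-cong x∼p)) x-rep

  σ-subst : ∀ {y y'} (e : y ≡ y') p → subst (λ z → Fin (Block.t z)) e (Block.σ y p) ≡ Block.σ y' p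
  σ-subst refl p = refl

  leaf-of-at : ∀ p x (r : IsRep x) → x ∼ p → leaf-of p ≡ code (blk x r (Block.σ x p))
  leaf-of-at p x r x∼p = cong code (move (rep-of r x∼p) (rep-idem p))
    where move : ∀ {y} → y ≡ x → (r' : IsRep y) → blk y r' (Block.σ y p) ≡ blk x r (Block.σ x p)
          move refl r' = blk-rep-irrelevant x r' r _

  blk-injective : ∀ {x y r r' j j'} → blk x r j ≡ blk y r' j' →
                  Σ[ e ∈ x ≡ y ] subst (λ z → Fin (Block.t z)) e j ≡ j'
  blk-injective refl = refl , refl

  code-injective : ∀ {u v} → code u ≡ code v → u ≡ v
  code-injective {u} {v} eq = trans (≡-sym (node-code u)) (trans (cong node eq) (node-code v))

  -- A leaf of a block stays a leaf: its only possible new neighbour is the hub,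
  -- attached to the root, and a leaf root has no neighbour in its block.
  leaf-up : ∀ x r j → IsLeaf (Block.T x) j → IsLeaf GT (code (blk x r j))
  leaf-up x r j leaf u w a₁ a₂ = node-injective
    (same (block-neighbour x r j (node u) (trans (≡-sym (adj-code (blk x r j) u)) a₁))
          (block-neighbour x r j (node w) (trans (≡-sym (adj-code (blk x r j) w)) a₂)))
    where
      root-isolated : j ≡ Block.root x → ∀ j' → adj (Block.T x) j j' ≡ true → ⊥
      root-isolated refl j' a with Block.root-attachable x
      ... | inj₁ ¬leaf   = ¬leaf leaf
      ... | inj₂ isolated = not-¬ a (isolated j')
      same : ∀ {v v'} →
        (v ≡ hub (A x) × j ≡ Block.root x) ⊎ Σ[ j' ∈ _ ] (v ≡ blk x r j' × adj (Block.T x) j j' ≡ true) →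
        (v' ≡ hub (A x) × j ≡ Block.root x) ⊎ Σ[ j' ∈ _ ] (v' ≡ blk x r j' × adj (Block.T x) j j' ≡ true) → v ≡ v'
      same (inj₁ (refl , _)) (inj₁ (refl , _)) = refl
      same (inj₂ (j₁ , refl , b₁)) (inj₂ (j₂ , refl , b₂)) = cong (blk x r) (leaf j₁ j₂ b₁ b₂)
      same (inj₁ (_ , root)) (inj₂ (j₂ , _ , b₂)) = ⊥-elim (root-isolated root j₂ b₂)
      same (inj₂ (j₁ , _ , b₁)) (inj₁ (_ , root)) = ⊥-elim (root-isolated root j₁ b₁)

  leaf-down : ∀ x r j → IsLeaf GT (code (blk x r j)) → IsLeaf (Block.T x) j
  leaf-down x r j leaf j₁ j₂ b₁ b₂ = same-block (code-injective (leaf _ _ (lift b₁) (lift b₂)))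
    where same-block : ∀ {r r' j j'} → blk x r j ≡ blk x r' j' → j ≡ j'
          same-block refl = refl
          lift : ∀ {j'} → adj (Block.T x) j j' ≡ true → adj GT (code (blk x r j)) (code (blk x r j')) ≡ true
          lift {j'} b = trans (adj-codes (blk x r j) (blk x r j')) (trans (adj-in-block x r r j j') b)

  -- The hub of a non-empty side has two neighbours: the other hub and a root.
  hub-not-leaf : ∀ s → Σ[ p ∈ Fin n ] A p ≡ s → ¬ IsLeaf GT (code (hub s))
  hub-not-leaf s (p , p-side) leaf with
    code-injective {hub (not s)} {root-node} (leaf _ _ (trans (adj-codes (hub s) (hub (not s))) (adj-hub-hub s)) to-root)
    where
      root-node : Node
      root-node = blk (rep p) (rep-idem p) (Block.root (rep p))
      rep-side : A (rep p) ≡ s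
      rep-side = trans (∼-side (rep-∼ p)) p-side
      to-root : adj GT (code (hub s)) (code root-node) ≡ true
      to-root = trans (adj-codes (hub s) root-node)
                      (subst (λ s → node-adj (hub s) root-node ≡ true) rep-side (adj-hub-root (rep p) (rep-idem p)))
  ... | ()

  leaf-of-leaf : ∀ p → IsLeaf GT (leaf-of p)
  leaf-of-leaf p = leaf-up (rep p) (rep-idem p) _ (Block.σ-leaf (rep p) p (∼-sym (rep-∼ p)))

  leaf-of-injective : ∀ p q → leaf-of p ≡ leaf-of q → p ≡ q
  leaf-of-injective p q eq with blk-injective (code-injective eq)
  ... | reps≡ , σ≡ = Block.σ-inj (rep q) p q (subst (_∼ p) reps≡ (∼-sym (rep-∼ p))) (∼-sym (rep-∼ q))
                       (trans (≡-sym (σ-subst reps≡ p)) σ≡)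

  leaf-of-onto : (∀ s → Σ[ p ∈ Fin n ] A p ≡ s) → ∀ l → IsLeaf GT l → Σ[ p ∈ Fin n ] (⊤ × leaf-of p ≡ l)
  leaf-of-onto sides l leaf = onto (node l) (code-node l)
    where
      onto : ∀ v → code v ≡ l → Σ[ p ∈ Fin n ] (⊤ × leaf-of p ≡ l)
      onto (hub s) refl = ⊥-elim (hub-not-leaf s (sides s) leaf)
      onto (blk x r j) refl with Block.σ-onto x j (leaf-down x r j leaf)
      ... | p , x∼p , σp≡j = p , tt , trans (leaf-of-at p x r x∼p) (cong (code ∘ blk x r) σp≡j)

  hub-injective : ∀ {s s'} → hub s ≡ hub s' → s ≡ s'
  hub-injective refl = refl

  blk-same-injective : ∀ {x r r' j j'} → blk x r j ≡ blk x r' j' → j ≡ j'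
  blk-same-injective refl = refl

  hub≢blk : ∀ {s x r j} → code (hub s) ≢ code (blk x r j)
  hub≢blk {s} {x} {r} {j} eq with code-injective {hub s} {blk x r j} eq
  ... | ()

  to-own-hub : ∀ {Z : Fin N → Set} p → (∀ j → Z (code (blk (rep p) (rep-idem p) j))) → Z (code (hub (A p))) →
               Reach GT Z (leaf-of p) (code (hub (A p)))
  to-own-hub p Z-block Z-hub =
    reach-trans (within-block (rep p) (rep-idem p) Z-block _ (Block.root (rep p))) (1 , step (Z-block _) root-hub (here Z-hub))
    where
      root-node : Node
      root-node = blk (rep p) (rep-idem p) (Block.root (rep p))
      root-hub : adj GT (code root-node) (code (hub (A p))) ≡ true
      root-hub = trans (adj-codes root-node (hub (A p)))
                       (subst (λ s → node-adj root-node (hub s) ≡ true) (∼-side (rep-∼ p)) (adj-hub-root (rep p) (rep-idem p)))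

  -- The parts of GT minus a block node blk x r j: walks of the tree of x
  -- avoiding j lift, and every vertex outside the component of x reaches its
  -- hub through its own block.
  module AroundBlock (x : Fin n) (r : IsRep x) (j : Fin (Block.t x)) where
    Avoid : Fin N → Set
    Avoid y = ¬ y ≡ code (blk x r j)

    lift-avoiding : ∀ {a b} → Reach (Block.T x) (λ y → ¬ y ≡ j) a b → Reach GT Avoid (code (blk x r a)) (code (blk x r b))
    lift-avoiding (l , W) = l , lift-walk x r (λ j' j'≢j eq → j'≢j (blk-same-injective (code-injective eq))) W

    outside-to-hub : ∀ q → ¬ x ∼ q → Reach GT Avoid (leaf-of q) (code (hub (A q)))
    outside-to-hub q x≁q = to-own-hub q avoids hub≢blk
      where avoids : ∀ j' → Avoid (code (blk (rep q) (rep-idem q) j'))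
            avoids j' eq = x≁q (subst (_∼ q) (proj₁ (blk-injective (code-injective eq))) (∼-sym (rep-∼ q)))

  -- The parts of GT minus the hub of side s: each component of side s lies
  -- in one part, and every vertex of the other side reaches the other hub.
  module AroundHub (s : Bool) where
    Avoid : Fin N → Set
    Avoid y = ¬ y ≡ code (hub s)

    other-hub : ∀ q → A q ≢ s → Avoid (code (hub (A q)))
    other-hub q q-off eq = q-off (hub-injective (code-injective eq))

    off-side-to-hub : ∀ q → A q ≢ s → Reach GT Avoid (leaf-of q) (code (hub (A q)))
    off-side-to-hub q q-off = to-own-hub q (λ _ eq → hub≢blk (≡-sym eq)) (other-hub q q-off)

    off-side-reach : ∀ p q → A p ≢ s → A q ≢ s → Reach GT Avoid (leaf-of p) (leaf-of q)
    off-side-reach p q p-off q-off = reach-trans (off-side-to-hub p p-off)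
      (reach-trans (hub-to-hub _ _ (other-hub p p-off) (other-hub q q-off)) (reach-sym (off-side-to-hub q q-off)))

    component-reach : ∀ p q → p ∼ q → Reach GT Avoid (leaf-of p) (leaf-of q)
    component-reach p q p∼q = subst (Reach GT Avoid (leaf-of p)) (≡-sym (leaf-of-at q (rep p) (rep-idem p) rep∼q))
      (within-block (rep p) (rep-idem p) (λ _ eq → hub≢blk (≡-sym eq)) _ _)
      where rep∼q : rep p ∼ q
            rep∼q = ∼-trans (∼-sym (rep-∼ p)) p∼q

  module Widths (sides : ∀ s → Σ[ p ∈ Fin n ] A p ≡ s) (d : ℕ) (cut : CutRankAtMost G All A d) where

    side-cutrank : ∀ s → CutRankAtMost G All (is-side s) d
    side-cutrank true  = cutrank-cong G (λ y → ≡-sym (is-true (A y))) cut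
      where is-true : ∀ b → does (b B.≟ true) ≡ b
            is-true true  = refl
            is-true false = refl
    side-cutrank false = cutrank-cong G (λ y → ≡-sym (is-false (A y))) (cutrank-complement G cut)
      where is-false : ∀ b → does (b B.≟ false) ≡ not b
            is-false true  = refl
            is-false false = refl

    other-side : ∀ s → Σ[ p ∈ Fin n ] A p ≢ s
    other-side s = proj₁ (sides (not s)) , λ eq → not-¬ eq (proj₂ (sides (not s)))

    -- At a block node of x, a union of parts S avoiding the other side lies in
    -- the component of x; its cut consists of edges inside the component
    -- (rank ≤ k, by the width of the tree of x) and edges to the other side
    -- (rank ≤ d).
    block-width : ∀ x r j → ¬ IsLeaf GT (code (blk x r j)) →
                  WidthAtMost G All GT leaf-of (code (blk x r j)) (Block.k x + d)
    block-width x r j ¬leaf = width-from-complements G GT leaf-of _ _ p₀ bound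
      where
        open AroundBlock x r j
        p₀ : Fin n
        p₀ = proj₁ (other-side (A x))
        x≁p₀ : ¬ x ∼ p₀
        x≁p₀ x∼p₀ = proj₂ (other-side (A x)) (∼-side x∼p₀)
        bound : ∀ S → (∀ p q → ⊤ → ⊤ → Reach GT Avoid (leaf-of p) (leaf-of q) → S p ≡ S q) →
                S p₀ ≡ false → CutRankAtMost G All S (Block.k x + d)
        bound S S-parts Sp₀ = cutrank-from-rank G (rank-xor inner across) (edge-split-component x S S⊆x)
          where
            S⊆x : ∀ q → S q ≡ true → x ∼ q
            S⊆x q Sq = decidable-stable (x ∼? q) λ x≁q → not-¬ Sq (trans (S-parts q p₀ tt tt
              (reach-trans (outside-to-hub q x≁q)
                (reach-trans (hub-to-hub _ _ hub≢blk hub≢blk) (reach-sym (outside-to-hub p₀ x≁p₀))))) Sp₀)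
            inside-parts : ∀ p q → x ∼ p → x ∼ q →
                           Reach (Block.T x) (λ y → ¬ y ≡ j) (Block.σ x p) (Block.σ x q) → S p ≡ S q
            inside-parts p q x∼p x∼q R = S-parts p q tt tt
              (subst₂ (Reach GT Avoid) (≡-sym (leaf-of-at p x r x∼p)) (≡-sym (leaf-of-at q x r x∼q)) (lift-avoiding R))
            inner : RankOn (λ v w → in-comp x v ∧ (in-comp x w ∧ adj G v w)) S (Block.k x)
            inner = rank-of-cutrank G (Block.width x j (¬leaf ∘ leaf-up x r j) S inside-parts) (x ∼?_)
            across : RankOn (λ v w → is-side (A x) v ∧ (not (is-side (A x) w) ∧ adj G v w)) S d
            across = rank-across G (side-cutrank (A x)) S

    -- At the hub of side s, a union of parts S avoiding the other side is a
    -- union of components of side s; only edges to the other side leave it.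
    hub-width : ∀ s → WidthAtMost G All GT leaf-of (code (hub s)) d
    hub-width s = width-from-complements G GT leaf-of _ _ p₀ bound
      where
        open AroundHub s
        p₀ : Fin n
        p₀ = proj₁ (other-side s)
        bound : ∀ S → (∀ p q → ⊤ → ⊤ → Reach GT Avoid (leaf-of p) (leaf-of q) → S p ≡ S q) →
                S p₀ ≡ false → CutRankAtMost G All S d
        bound S S-parts Sp₀ = cutrank-from-rank G (rank-across G (side-cutrank s) S) (edge-split-side s S S⊆s S-comp)
          where
            S⊆s : ∀ q → S q ≡ true → A q ≡ s
            S⊆s q Sq = decidable-stable (side? s q) λ q-off →
              not-¬ Sq (trans (S-parts q p₀ tt tt (off-side-reach q p₀ q-off (proj₂ (other-side s)))) Sp₀)
            S-comp : ∀ p q → p ∼ q → S p ≡ S q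
            S-comp p q p∼q = S-parts p q tt tt (component-reach p q p∼q)

    width : ∀ i → ¬ IsLeaf GT i → WidthAtMost G All GT leaf-of i (m + d)
    width i ¬leaf = subst (λ i → ¬ IsLeaf GT i → WidthAtMost G All GT leaf-of i (m + d)) (code-node i) (at (node i)) ¬leaf
      where
        at : ∀ v → ¬ IsLeaf GT (code v) → WidthAtMost G All GT leaf-of (code v) (m + d)
        at (hub s)     _      S S-parts = cutrank-mono G (ℕP.m≤n+m d m) (hub-width s S S-parts)
        at (blk x r j) ¬leaf S S-parts = cutrank-mono G (ℕP.+-monoˡ-≤ d (Block.k≤m x)) (block-width x r j ¬leaf S S-parts)

    decomposition : 1 ≤ d → HasDecomposition G All (m + d + 1)
    decomposition 1≤d =
      N , GT , leaf-of , tree , (λ p _ → leaf-of-leaf p) , (λ p q _ _ → leaf-of-injective p q) , leaf-of-onto sides ,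
      (λ i ¬leaf S S-parts → cutrank-mono G (ℕP.m≤m+n (m + d) 1) (width i ¬leaf S S-parts)) ,
      (code (hub true) , λ i → let (l , l≤m+2 , W) = radius i in l , ℕP.≤-trans l≤m+2 m+2≤bound , W)
      where
        open ℕP.≤-Reasoning
        m+2≤bound : suc (suc m) ≤ m + d + 1
        m+2≤bound = begin
          suc (suc m)   ≡⟨ cong suc (ℕP.+-comm 1 m) ⟩
          suc (m + 1)   ≡⟨ ℕP.+-comm 1 (m + 1) ⟩
          m + 1 + 1     ≤⟨ ℕP.+-monoˡ-≤ 1 (ℕP.+-monoʳ-≤ m 1≤d) ⟩
          m + d + 1     ∎

module _ {m d : ℕ} (1≤m : 1 ≤ m) (1≤d : 1 ≤ d) {n : ℕ} (G : Graph n) where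

  glue-components : (A : Fin n → Bool) → (∀ x → RankDepthAtMost G (Components._∼_ G A x) m) →
                    CutRankAtMost G All A d → (∀ s → Σ[ p ∈ Fin n ] A p ≡ s) → RankDepthAtMost G All (m + d + 1)
  glue-components A bounds cut sides = inj₂ (m + d + 1 , ℕP.≤-refl , Glue.Widths.decomposition G A m rooted sides d cut 1≤d)
    where
      open Components G A
      rooted : ∀ x → RootedDecomposition G (x ∼_) m
      rooted x = rooted-decomposition G 1≤m x (∼-refl x) (bounds x)

  -- If G is connected its rank-depth is at most
  -- m; otherwise split off the component of v₀ instead, a partition with the
  -- same components, both sides non-empty and no crossing edges.
  module OneSided (A : Fin n → Bool) (s : Bool) (one-side : ∀ p → A p ≡ s) (v₀ : Fin n) where
    open Components G A

    same-side : ∀ p q → A p ≡ A q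
    same-side p q = trans (one-side p) (≡-sym (one-side q))

    A' : Fin n → Bool
    A' = in-comp v₀
    module C' = Components G A'

    A'-cong : ∀ {x y} → x ∼ y → A' x ≡ A' y
    A'-cong x∼y = does-⇔ (mk⇔ (λ v₀∼x → ∼-trans v₀∼x x∼y) (λ v₀∼y → ∼-trans v₀∼y (∼-sym x∼y))) (v₀ ∼? _) (v₀ ∼? _)

    -- The components for A' are those for A: on them A' is constant.
    from-A' : ∀ x y → x C'.∼ y → x ∼ y
    from-A' x y (_ , R) = same-side y x , reach-weaken (λ z _ → same-side z x) R

    to-A' : ∀ x y → x ∼ y → x C'.∼ y
    to-A' x y x∼y@(_ , (l , W)) =
      ≡-sym (A'-cong x∼y) , (l , walk-weaken (λ z x∼z → ≡-sym (A'-cong x∼z)) (walk-reachable W))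

    -- No edge leaves a component of a side containing all vertices.
    cut' : CutRankAtMost G All A' d
    cut' = cutrank-no-edges G λ v w v-in w-out → ¬-not λ a →
      not-¬ (dec-true (v₀ ∼? w) (∼-step (true⇒holds (v₀ ∼? v) v-in) a (same-side w v))) w-out

    one-sided : (∀ x → RankDepthAtMost G (x ∼_) m) → RankDepthAtMost G All (m + d + 1)
    one-sided bounds with all? (v₀ ∼?_)
    ... | yes connected = rankdepth-mono G (ℕP.≤-trans (ℕP.m≤m+n m d) (ℕP.m≤m+n (m + d) 1))
                            (rankdepth-cong G (λ _ _ → tt) (λ v _ → connected v) (bounds v₀))
    ... | no ¬connected with FP.¬∀⟶∃¬ n _ (v₀ ∼?_) ¬connected
    ...   | p₀ , v₀≁p₀ = glue-components A' (λ x → rankdepth-cong G (to-A' x) (from-A' x) (bounds x)) cut' sides'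
      where sides' : ∀ s → Σ[ p ∈ Fin n ] A' p ≡ s
            sides' true  = v₀ , dec-true (v₀ ∼? v₀) (∼-refl v₀)
            sides' false = p₀ , dec-false (v₀ ∼? p₀) v₀≁p₀

PartitionShape : ∀ {n} → (Fin n → Bool) → Set
PartitionShape {n} A = (∀ s → Σ[ p ∈ Fin n ] A p ≡ s) ⊎ (Σ[ s ∈ Bool ] (Fin n × ∀ p → A p ≡ s)) ⊎ ¬ Fin n

partition-shape : ∀ {n} (A : Fin n → Bool) → PartitionShape A
partition-shape A with any? (λ p → A p B.≟ true) | any? (λ p → A p B.≟ false)
... | yes on-true      | yes on-false = inj₁ λ { true → on-true ; false → on-false }
... | yes (v₀ , _)     | no ¬false    = inj₂ (inj₁ (true , v₀ , λ p → ¬-not (λ Ap≡f → ¬false (p , Ap≡f))))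
... | no ¬true         | yes (v₀ , _) = inj₂ (inj₁ (false , v₀ , λ p → ¬-not (λ Ap≡t → ¬true (p , Ap≡t))))
... | no ¬true         | no ¬false    =
  inj₂ (inj₂ λ p → [ (λ t → ¬true (p , t)) , (λ f → ¬false (p , f)) ]′ (bool-cases (A p)))
  where bool-cases : ∀ b → b ≡ true ⊎ b ≡ false
        bool-cases true  = inj₁ refl
        bool-cases false = inj₂ refl

component-bounds : ∀ {n m} (G : Graph n) (A : Fin n → Bool) →
  (∀ a → A a ≡ true → RankDepthAtMost G (Component G A true a) m) →
  (∀ b → A b ≡ false → RankDepthAtMost G (Component G A false b) m) →
  ∀ x → RankDepthAtMost G (Components._∼_ G A x) m
component-bounds G A true-bounds false-bounds x with A x in side
... | true  = true-bounds x side
... | false = false-bounds x side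

lemma2p7 : (m d : ℕ) → 1 ≤ m → 1 ≤ d →
    {n : ℕ} (G : Graph n) (A : Fin n → Bool) →
    (∀ a → A a ≡ true → RankDepthAtMost G (Component G A true a) m) →
    (∀ b → A b ≡ false → RankDepthAtMost G (Component G A false b) m) →
    CutRankAtMost G All A d →
    RankDepthAtMost G All (m + d + 1)
lemma2p7 m d 1≤m 1≤d G A true-bounds false-bounds cut = by-shape (partition-shape A)
  where
    bounds : ∀ x → RankDepthAtMost G (Components._∼_ G A x) m
    bounds = component-bounds G A true-bounds false-bounds
    by-shape : PartitionShape A → RankDepthAtMost G All (m + d + 1)
    by-shape (inj₁ sides)                      = glue-components 1≤m 1≤d G A bounds cut sides
    by-shape (inj₂ (inj₁ (s , v₀ , one-side))) = OneSided.one-sided 1≤m 1≤d G A s one-side v₀ bounds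
    by-shape (inj₂ (inj₂ no-vertex))           = inj₁ (λ x → ⊥-elim (no-vertex x))
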